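{- If a clause $c$ of a CNF formula $F$ is superredundant in $F$, then for every clause $c'$, $c$ is also superredundant in $F \cup \{c'\}$.
   Context: A CNF formula is a finite set of clauses; a clause is a finite set of literals, read as their disjunction. Tautological clauses are not allowed. Resolution: from clauses $c_1 \vee l$ and $c_2 \vee \neg l$ derive $c_1 \vee c_2$; two clauses whose resolvent would be a tautology are considered not to resolve. The resolution closure $\mathrm{ResCn}(F)$ is the set of all clauses obtainable from $F$ by zero or more resolution steps. A clause $c \in F$ is superredundant in $F$ if $\mathrm{ResCn}(F) \setminus \{c\} \models c$. -}

module Defs where

open import Data.Nat using (ℕ)
open import Data.Bool using (Bool; true; false)
open import Data.Product using (Σ; _×_; _,_; proj₁; proj₂)
open import Data.Sum using (_⊎_)
open import Data.List using (List; _∷_)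
open import Data.List.Membership.Propositional using (_∈_)
open import Data.List.Relation.Unary.Any using (Any)
open import Relation.Binary.PropositionalEquality using (_≡_; _≢_)
open import Relation.Nullary using (¬_)
open import Function.Bundles using (_⇔_)

Literal : Set
Literal = ℕ × Bool

var : Literal → ℕ
var = proj₁

pol : Literal → Bool
pol = proj₂

pos neg : ℕ → Literal
pos x = x , true
neg x = x , false

-- A clause is a finite set of literals, represented by a list; only its
-- membership relation matters (clauses are compared as sets).
Clause : Set
Clause = List Literal

_≈_ : Clause → Clause → Set
c ≈ d = ∀ l → (l ∈ c) ⇔ (l ∈ d)

Tautology : Clause → Set
Tautology c = Σ ℕ (λ x → (pos x ∈ c) × (neg x ∈ c))

NonTaut : Clause → Set
NonTaut c = ¬ Tautology c

Formula : Set
Formula = List Clause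

_∈F_ : Clause → Formula → Set
c ∈F F = Any (λ d → d ≈ c) F

IsCNF : Formula → Set
IsCNF F = ∀ c → c ∈F F → NonTaut c

IsResolvent : Clause → Clause → ℕ → Clause → Set
IsResolvent d₁ d₂ x r =
  ∀ l → (l ∈ r) ⇔ (((l ∈ d₁) × (l ≢ pos x)) ⊎ ((l ∈ d₂) × (l ≢ neg x)))

data ResCn (F : Formula) : Clause → Set where
  base    : ∀ {c} → c ∈F F → ResCn F c
  resolve : ∀ {d₁ d₂ r} (x : ℕ) → ResCn F d₁ → ResCn F d₂ →
            pos x ∈ d₁ → neg x ∈ d₂ → IsResolvent d₁ d₂ x r →
            NonTaut r → ResCn F r

Assignment : Set
Assignment = ℕ → Bool

Sat : Assignment → Clause → Set
Sat α c = Any (λ l → α (var l) ≡ pol l) c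

Superredundant : Clause → Formula → Set
Superredundant c F =
  ∀ (α : Assignment) →
    (∀ d → ResCn F d → ¬ (d ≈ c) → Sat α d) → Sat α c

{-# OPTIONS --safe #-}
module Submission where

open import Defs
open import Data.List using (_∷_)
open import Data.List.Relation.Unary.Any using (there)
open import Relation.Unary using (_⊆_)

ResCn-mono : ∀ {F G} → (_∈F F) ⊆ (_∈F G) → ResCn F ⊆ ResCn G
ResCn-mono F⊆G (base c∈F) = base (F⊆G c∈F)
ResCn-mono F⊆G (resolve x d₁ d₂ x∈d₁ ¬x∈d₂ res nontaut) =
  resolve x (ResCn-mono F⊆G d₁) (ResCn-mono F⊆G d₂) x∈d₁ ¬x∈d₂ res nontaut

Superredundant-mono : ∀ {F G c} → (_∈F F) ⊆ (_∈F G) →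
  Superredundant c F → Superredundant c G
Superredundant-mono F⊆G sr α satG = sr α (λ d d∈F d≉c → satG d (ResCn-mono F⊆G d∈F) d≉c)

-- Superredundancy survives any enlargement of the formula.
lemma11 : (F : Formula) → IsCNF F → (c : Clause) → c ∈F F →
    Superredundant c F →
    (c' : Clause) → NonTaut c' → Superredundant c (c' ∷ F)
lemma11 F _ c _ sr c' _ = Superredundant-mono there sr
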